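{- Let $\bar\Gamma$ be a connected undirected simple graph that contains an induced subgraph isomorphic to a graph of type $D_n^{(1)}$. Then $\bar\Gamma$ is not BM-equivalent to any Dynkin graph.
   Context: A graph of type $D_n^{(1)}$ is a path $a_1-\dots-a_m$ ($m\ge1$) with two extra leaves attached to $a_1$ and two extra leaves attached to $a_m$; for $m=1$ this is a star with four leaves. Basic move: for adjacent vertices $a,c$, $\phi_{c,a}$ toggles adjacency between $c$ and every vertex $x\ne c$ adjacent to $a$, leaving other edges unchanged. BM-equivalence is generated by basic moves. Dynkin graphs are the trees $A_n$ (path), $D_n$ (path with two leaves at one end), $E_6,E_7,E_8$, which have a branch vertex with arms of lengths $(1,2,2),(1,2,3),(1,2,4)$. -}

module Defs where

open import Data.Bool using (Bool; true; false; _∧_; _∨_; not; _xor_)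
open import Data.Nat using (ℕ; zero; suc; _+_; _∸_; _≡ᵇ_)
open import Data.Fin using (Fin; toℕ)
open import Data.List using (List; []; _∷_; map; upTo; _++_)
open import Data.Bool.ListAction using (any)
open import Data.Product using (Σ; ∃; ∃₂; _×_; _,_)
open import Function.Bundles using (_⤖_; Bijection)
open import Relation.Binary.PropositionalEquality using (_≡_)
open import Relation.Binary.Construct.Closure.ReflexiveTransitive using (Star)
open import Relation.Binary.Construct.Closure.Equivalence using (EqClosure)

Adj : ℕ → Set
Adj n = Fin n → Fin n → Bool

record IsSimple {n : ℕ} (G : Adj n) : Set where
  field
    symm    : ∀ x y → G x y ≡ G y x
    irrefl  : ∀ x → G x x ≡ false

Edge : ∀ {n} → Adj n → Fin n → Fin n → Set
Edge G x y = G x y ≡ true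

Connected : ∀ {n} → Adj n → Set
Connected G = ∀ x y → Star (Edge G) x y

_==_ : ∀ {n} → Fin n → Fin n → Bool
x == y = toℕ x ≡ᵇ toℕ y

-- Basic move φ_{c,a}: toggles the adjacency between c and every x ≠ c adjacent to a.
basicMove : ∀ {n} → Fin n → Fin n → Adj n → Adj n
basicMove c a G x y =
  G x y xor ( ((x == c) ∧ not (y == c) ∧ G a y)
            ∨ ((y == c) ∧ not (x == c) ∧ G a x))

BMStep : ∀ {n} → Adj n → Adj n → Set
BMStep {n} G H = ∃₂ λ (c a : Fin n) → Edge G c a × (∀ x y → H x y ≡ basicMove c a G x y)

BMEquiv : ∀ {n} → Adj n → Adj n → Set
BMEquiv = EqClosure BMStep

Iso : ∀ {m n} → Adj m → Adj n → Set
Iso {m} {n} G H = Σ (Fin m ⤖ Fin n) λ f →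
  ∀ x y → H (Bijection.to f x) (Bijection.to f y) ≡ G x y

HasInduced : ∀ {n k} → Adj n → Adj k → Set
HasInduced {n} {k} G H = Σ (Fin k → Fin n) λ f →
  (∀ i j → f i ≡ f j → i ≡ j) × (∀ i j → G (f i) (f j) ≡ H i j)

fromEdges : ∀ {k} → List (ℕ × ℕ) → Adj k
fromEdges es x y = any (λ { (a , b) → ((toℕ x ≡ᵇ a) ∧ (toℕ y ≡ᵇ b)) ∨ ((toℕ x ≡ᵇ b) ∧ (toℕ y ≡ᵇ a)) }) es

pathEdges : ℕ → List (ℕ × ℕ)
pathEdges k = map (λ i → (i , suc i)) (upTo (k ∸ 1))

data DynkinType : ℕ → Set where
  A  : ∀ k → DynkinType (suc k)          -- A_{k+1}, k+1 ≥ 1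
  D  : ∀ k → DynkinType (4 + k)          -- D_{k+4}, k+4 ≥ 4
  E6 : DynkinType 6
  E7 : DynkinType 7
  E8 : DynkinType 8

-- Tree with branch vertex 0 and arms of lengths 1, 2, r:
-- arm 1: 1 ; arm 2: 2-3 ; arm 3: 4-5-…-(3+r).
armEdges : ℕ → List (ℕ × ℕ)
armEdges r = (0 , 1) ∷ (0 , 2) ∷ (2 , 3) ∷ (0 , 4) ∷ map (λ i → (4 + i , 5 + i)) (upTo (r ∸ 1))

dynkinEdges : ∀ {n} → DynkinType n → List (ℕ × ℕ)
dynkinEdges (A k) = pathEdges (suc k)
-- D_{k+4}: path 0-1-…-(k+2) plus a leaf k+3 attached to 1 (so 0 and k+3 are two leaves at 1)
dynkinEdges (D k) = pathEdges (3 + k) ++ ((1 , 3 + k) ∷ [])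
dynkinEdges E6 = armEdges 2
dynkinEdges E7 = armEdges 3
dynkinEdges E8 = armEdges 4

dynkinGraph : ∀ {n} → DynkinType n → Adj n
dynkinGraph t = fromEdges (dynkinEdges t)

IsDynkin : ∀ {n} → Adj n → Set
IsDynkin {n} G = Σ (DynkinType n) λ t → Iso G (dynkinGraph t)

-- Graph of type D^(1): path a_0-…-a_{m-1} (m = k+1 ≥ 1) on vertices 0..m-1,
-- leaves m, m+1 attached to 0 and leaves m+2, m+3 attached to m-1.
affineDEdges : ℕ → List (ℕ × ℕ)
affineDEdges k = pathEdges (suc k) ++
  ((0 , suc k) ∷ (0 , 2 + k) ∷ (k , 3 + k) ∷ (k , 4 + k) ∷ [])

affineD : ∀ k → Adj (5 + k)
affineD k = fromEdges (affineDEdges k)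

-- A companion of a graph G is a symmetric integer matrix S with 2 on the diagonal and
-- S ≡ adjacency matrix of G (mod 2) whose quadratic form is positive definite. For an edge
-- c – a, the basic move φ_{c,a} is matched by the unimodular change of basis
-- e_c ↦ e_c − S_ca e_a: since S_ca is odd, it toggles exactly the parities that φ_{c,a}
-- toggles. So having a companion is invariant under BM-equivalence; it also passes to induced
-- subgraphs. Dynkin graphs have one, their Cartan matrix, which is the Gram matrix of the
-- simple roots. A graph of type D^(1) has none: φ_{1,0} attaches the leaves of the end
-- vertex 0 to its neighbour 1, so deleting 0 leaves a graph of type D^(1) with a shorter path.
-- For the star with four leaves, positivity forces the hub–leaf entries s_i to be ±1 and the
-- leaf–leaf entries to be 0, and then 2 e_hub − Σ s_i e_i is isotropic.

module Submission where

open import Defs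
open import Data.Nat using (ℕ)
open import Data.Product using (Σ; _×_)
open import Relation.Nullary using (¬_)

open import Data.Bool using (Bool; true; false; _∧_; _∨_; not; _xor_; if_then_else_; T)
import Data.Bool.Properties as BP
open import Data.Empty using (⊥-elim)
open import Data.Fin as Fin using (Fin; toℕ; _↑ˡ_)
open import Data.Fin.Patterns using (0F; 1F; 2F; 3F; 4F)
import Data.Fin.Properties as FP
open import Data.Integer as ℤ using (ℤ; +_; -[1+_]; _+_; _*_; -_; _-_; _≤_; +≤+)
import Data.Integer.Properties as ZP
open import Algebra.Properties.Semiring.Sum ZP.+-*-semiring
  using (sum; sum-cong-≗; ∑-distrib-+; *-distribˡ-sum; sum-replicate-zero)
open import Data.Integer.Tactic.RingSolver using (solve-∀)
open import Data.List using (List; []; _∷_; _++_; map; applyUpTo)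
import Data.List.Properties as LP
open import Data.List.Relation.Unary.All using (All; []; _∷_)
import Data.List.Relation.Unary.All.Properties as AllP
open import Data.Nat as ℕ using (zero; suc; _≡ᵇ_; _<ᵇ_; _<_; s≤s; z≤n)
import Data.Nat.Properties as NP
open import Data.Product as Product using (_,_; proj₁; proj₂; map₂)
open import Data.Sum using (_⊎_; inj₁; inj₂)
open import Data.Vec using (Vec; []; _∷_; lookup; tabulate)
open import Data.Vec.Functional using (Vector)
open import Data.Vec.Properties using (lookup∘tabulate)
open import Function using (id; _∘_)
open import Function.Bundles using (Bijection)
open import Relation.Binary.Construct.Closure.ReflexiveTransitive using (ε; _◅_)
open import Relation.Binary.Construct.Closure.Symmetric using (fwd; bwd)
open import Relation.Binary.PropositionalEquality
open import Relation.Nullary using (Dec; yes; no)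
open import Relation.Nullary.Decidable using (from-yes)

≡ᵇ-refl : ∀ n → (n ≡ᵇ n) ≡ true
≡ᵇ-refl zero    = refl
≡ᵇ-refl (suc n) = ≡ᵇ-refl n

≡ᵇ-sym : ∀ m n → (m ≡ᵇ n) ≡ (n ≡ᵇ m)
≡ᵇ-sym zero    zero    = refl
≡ᵇ-sym zero    (suc n) = refl
≡ᵇ-sym (suc m) zero    = refl
≡ᵇ-sym (suc m) (suc n) = ≡ᵇ-sym m n

≡ᵇ⇒≡ : ∀ m n → (m ≡ᵇ n) ≡ true → m ≡ n
≡ᵇ⇒≡ m n eq = NP.≡ᵇ⇒≡ m n (subst T (sym eq) _)

≢⇒≡ᵇ-false : ∀ {m n} → m ≢ n → (m ≡ᵇ n) ≡ false
≢⇒≡ᵇ-false {m} {n} m≢n with m ≡ᵇ n in eq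
... | true  = ⊥-elim (m≢n (≡ᵇ⇒≡ m n eq))
... | false = refl

≡ᵇ-false⇒≢ : ∀ {m n} → (m ≡ᵇ n) ≡ false → m ≢ n
≡ᵇ-false⇒≢ {m} m≠n refl with trans (sym m≠n) (≡ᵇ-refl m)
... | ()

==-refl : ∀ {n} (x : Fin n) → (x == x) ≡ true
==-refl x = ≡ᵇ-refl (toℕ x)

==-sym : ∀ {n} (x y : Fin n) → (x == y) ≡ (y == x)
==-sym x y = ≡ᵇ-sym (toℕ x) (toℕ y)

==⇒≡ : ∀ {n} (x y : Fin n) → (x == y) ≡ true → x ≡ y
==⇒≡ x y eq = FP.toℕ-injective (≡ᵇ⇒≡ (toℕ x) (toℕ y) eq)

≢⇒==-false : ∀ {n} {x y : Fin n} → x ≢ y → (x == y) ≡ false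
≢⇒==-false x≢y = ≢⇒≡ᵇ-false (x≢y ∘ FP.toℕ-injective)

==-injective : ∀ {m n} {f : Fin m → Fin n} → (∀ i j → f i ≡ f j → i ≡ j) →
               ∀ i j → (f i == f j) ≡ (i == j)
==-injective {f = f} f-inj i j with i Fin.≟ j
... | yes refl = trans (==-refl (f i)) (sym (==-refl i))
... | no  i≢j  = trans (≢⇒==-false (i≢j ∘ f-inj i j)) (sym (≢⇒==-false i≢j))

toℤ : Bool → ℤ
toℤ b = if b then + 1 else + 0

δ : ∀ {n} → Fin n → Fin n → ℤ
δ x y = toℤ (x == y)

-- Parity

record Parity (b : Bool) (z : ℤ) : Set where
  constructor mod2
  field
    half : ℤ
    eq   : z ≡ toℤ b + half * + 2

parity-two : Parity false (+ 2)
parity-two = mod2 (+ 1) refl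

parity-neg : ∀ {z} → Parity true z → Parity true (- z)
parity-neg (mod2 k refl) = mod2 (- + 1 - k) (identity k)
  where
  identity : ∀ k → - (+ 1 + k * + 2) ≡ + 1 + (- + 1 - k) * + 2
  identity = solve-∀

parity-xor : ∀ {b₁ b₂ z₁ z₂ t} → Parity b₁ z₁ → Parity b₂ z₂ → Parity true t →
             Parity (b₁ xor b₂) (z₁ + t * z₂)
parity-xor {b₁} {b₂} (mod2 k₁ refl) (mod2 k₂ refl) (mod2 k refl) =
  mod2 w (trans (identity (toℤ b₁) (toℤ b₂) k₁ k₂ k) (cong (λ p → p + w * + 2) (sym (toℤ-xor b₁ b₂))))
  where
  w = k₁ + k₂ + k * toℤ b₂ + + 2 * k * k₂ + toℤ b₁ * toℤ b₂
  toℤ-xor : ∀ p q → toℤ (p xor q) ≡ toℤ p + toℤ q - + 2 * (toℤ p * toℤ q)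
  toℤ-xor true  true  = refl
  toℤ-xor true  false = refl
  toℤ-xor false true  = refl
  toℤ-xor false false = refl
  identity : ∀ p q k₁ k₂ k →
             p + k₁ * + 2 + (+ 1 + k * + 2) * (q + k₂ * + 2)
             ≡ p + q - + 2 * (p * q) + (k₁ + k₂ + k * q + + 2 * k * k₂ + p * q) * + 2
  identity = solve-∀

odd≢even : ∀ k j → + 1 + k * + 2 ≢ + 0 + j * + 2
odd≢even k j odd≡even = 1≢2* ℤ.∣ j - k ∣ (begin
  ℤ.∣ + 1 ∣                           ≡⟨ cong ℤ.∣_∣ (cancel k) ⟨
  ℤ.∣ + 1 + k * + 2 - k * + 2 ∣        ≡⟨ cong (λ z → ℤ.∣ z - k * + 2 ∣) odd≡even ⟩
  ℤ.∣ + 0 + j * + 2 - k * + 2 ∣        ≡⟨ cong ℤ.∣_∣ (factor j k) ⟩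
  ℤ.∣ (j - k) * + 2 ∣                 ≡⟨ ZP.abs-* (j - k) (+ 2) ⟩
  ℤ.∣ j - k ∣ ℕ.* 2                   ∎)
  where
  open ≡-Reasoning
  cancel : ∀ k → + 1 + k * + 2 - k * + 2 ≡ + 1
  cancel = solve-∀
  factor : ∀ j k → + 0 + j * + 2 - k * + 2 ≡ (j - k) * + 2
  factor = solve-∀
  1≢2* : ∀ m → 1 ≢ m ℕ.* 2
  1≢2* zero    ()
  1≢2* (suc m) ()

parity-unique : ∀ {b b′ z} → Parity b z → Parity b′ z → b ≡ b′
parity-unique {true}  {true}  _        _        = refl
parity-unique {false} {false} _        _        = refl
parity-unique {true}  {false} (mod2 k eq) (mod2 j eq′) = ⊥-elim (odd≢even k j (trans (sym eq) eq′))
parity-unique {false} {true}  (mod2 k eq) (mod2 j eq′) = ⊥-elim (odd≢even j k (trans (sym eq′) eq))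

-- Companions

-- Vectors of ℤⁿ, as formal sums Σ c · e_u.
Combination : ℕ → Set
Combination n = List (ℤ × Fin n)

Matrix : ℕ → Set
Matrix n = Fin n → Fin n → ℤ

coeff : ∀ {n} → Combination n → Fin n → ℤ
coeff []            w = + 0
coeff ((c , u) ∷ L) w = c * δ u w + coeff L w

pairing : ∀ {n} → Matrix n → Fin n → Combination n → ℤ
pairing S x []            = + 0
pairing S x ((c , y) ∷ M) = c * S x y + pairing S x M

form : ∀ {n} → Matrix n → Combination n → Combination n → ℤ
form S []            M = + 0
form S ((c , x) ∷ L) M = c * pairing S x M + form S L M

PositiveDefinite : ∀ {n} → Matrix n → Set
PositiveDefinite {n} S = ∀ (L : Combination n) → form S L L ≤ + 0 → ∀ w → coeff L w ≡ + 0

pairing-cong : ∀ {n} {S T : Matrix n} → (∀ x y → S x y ≡ T x y) → ∀ x M → pairing S x M ≡ pairing T x M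
pairing-cong S≡T x []            = refl
pairing-cong S≡T x ((c , y) ∷ M) = cong₂ (λ p q → c * p + q) (S≡T x y) (pairing-cong S≡T x M)

form-cong : ∀ {n} {S T : Matrix n} → (∀ x y → S x y ≡ T x y) → ∀ L M → form S L M ≡ form T L M
form-cong S≡T []            M = refl
form-cong S≡T ((c , x) ∷ L) M = cong₂ (λ p q → c * p + q) (pairing-cong S≡T x M) (form-cong S≡T L M)

record Companion {n} (G : Adj n) : Set where
  field
    S         : Matrix n
    symmetric : ∀ x y → S x y ≡ S y x
    diagonal  : ∀ x → S x x ≡ + 2
    parity    : ∀ x y → Parity (G x y) (S x y)
    positive  : PositiveDefinite S

  loopless : ∀ x → G x x ≡ false
  loopless x = parity-unique (subst (Parity (G x x)) (diagonal x) (parity x x)) parity-two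

companion-cong : ∀ {n} {G H : Adj n} → (∀ x y → G x y ≡ H x y) → Companion G → Companion H
companion-cong G≡H C = record
  { Companion C
  ; parity = λ x y → subst (λ b → Parity b (S x y)) (G≡H x y) (parity x y)
  }
  where open Companion C

restrict : ∀ {m n} {G : Adj n} {H : Adj m} → HasInduced G H → Companion G → Companion H
restrict {m} {n} (f , f-inj , f-adj) C = record
  { S         = S′
  ; symmetric = λ i j → symmetric (f i) (f j)
  ; diagonal  = λ i → diagonal (f i)
  ; parity    = λ i j → subst (λ b → Parity b (S′ i j)) (f-adj i j) (parity (f i) (f j))
  ; positive  = positive′
  }
  where
  open Companion C
  S′ : Matrix m
  S′ i j = S (f i) (f j)

  push : Combination m → Combination n
  push = map (map₂ f)

  pairing-push : ∀ i M → pairing S′ i M ≡ pairing S (f i) (push M)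
  pairing-push i []            = refl
  pairing-push i ((c , j) ∷ M) = cong (λ p → c * S′ i j + p) (pairing-push i M)

  form-push : ∀ L M → form S′ L M ≡ form S (push L) (push M)
  form-push []            M = refl
  form-push ((c , i) ∷ L) M = cong₂ (λ p q → c * p + q) (pairing-push i M) (form-push L M)

  coeff-push : ∀ L w → coeff (push L) (f w) ≡ coeff L w
  coeff-push []            w = refl
  coeff-push ((c , i) ∷ L) w =
    cong₂ (λ p q → c * toℤ p + q) (==-injective f-inj i w) (coeff-push L w)

  positive′ : PositiveDefinite S′
  positive′ L form≤0 w =
    trans (sym (coeff-push L w)) (positive (push L) (subst (_≤ + 0) (form-push L L) form≤0) (f w))

iso⇒induced : ∀ {m n} {G : Adj m} {H : Adj n} → Iso G H → HasInduced H G
iso⇒induced (f , f-adj) = Bijection.to f , (λ _ _ → Bijection.injective f) , f-adj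

-- Basic moves

module BasicMove {n} {G : Adj n} (C : Companion G) {c a : Fin n} (ca : Edge G c a) where
  open Companion C

  t : ℤ
  t = - S c a

  -- S′ = Pᵀ S P for the unimodular P with P e_c = e_c + t e_a; `transform` below is P.
  S′ : Matrix n
  S′ x y = S x y + t * (δ x c * S a y) + t * (δ y c * S x a) + t * t * (δ x c * δ y c * S a a)

  c≢a : c ≢ a
  c≢a refl with trans (sym ca) (loopless c)
  ... | ()

  t-odd : Parity true t
  t-odd = parity-neg (subst (λ b → Parity b (S c a)) ca (parity c a))

  symmetric′ : ∀ x y → S′ x y ≡ S′ y x
  symmetric′ x y rewrite symmetric x y | symmetric x a | symmetric a y =
    identity (S y x) (S y a) (S a x) (S a a) t (δ x c) (δ y c)
    where
    identity : ∀ s p q r t dx dy →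
               s + t * (dx * p) + t * (dy * q) + t * t * (dx * dy * r)
               ≡ s + t * (dy * q) + t * (dx * p) + t * t * (dy * dx * r)
    identity = solve-∀

  entry-at-c : S c c + t * (+ 1 * S a c) + t * (+ 1 * S c a) + t * t * (+ 1 * + 1 * S a a) ≡ S c c
  entry-at-c rewrite symmetric a c | diagonal a = identity (S c c) (S c a)
    where
    identity : ∀ s u → s + - u * (+ 1 * u) + - u * (+ 1 * u) + - u * - u * (+ 1 * + 1 * + 2) ≡ s
    identity = solve-∀

  entry-off-c : ∀ s p q r → s + t * (+ 0 * p) + t * (+ 0 * q) + t * t * (+ 0 * + 0 * r) ≡ s
  entry-off-c s p q r = identity s p q r t
    where
    identity : ∀ s p q r t → s + t * (+ 0 * p) + t * (+ 0 * q) + t * t * (+ 0 * + 0 * r) ≡ s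
    identity = solve-∀

  diagonal′ : ∀ x → S′ x x ≡ + 2
  diagonal′ x = trans (fixed (x == c) refl) (diagonal x)
    where
    fixed : ∀ b → (x == c) ≡ b →
            S x x + t * (toℤ b * S a x) + t * (toℤ b * S x a) + t * t * (toℤ b * toℤ b * S a a) ≡ S x x
    fixed false _   = entry-off-c (S x x) (S a x) (S x a) (S a a)
    fixed true  x=c with ==⇒≡ x c x=c
    ... | refl = entry-at-c

  parity′ : ∀ x y → Parity (basicMove c a G x y) (S′ x y)
  parity′ x y = moved (x == c) (y == c) refl refl
    where
    moved : ∀ bx by → (x == c) ≡ bx → (y == c) ≡ by →
            Parity (G x y xor ((bx ∧ not by ∧ G a y) ∨ (by ∧ not bx ∧ G a x)))
                   (S x y + t * (toℤ bx * S a y) + t * (toℤ by * S x a) + t * t * (toℤ bx * toℤ by * S a a))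
    moved false false _ _ =
      subst₂ Parity (sym (BP.xor-identityʳ (G x y))) (sym (entry-off-c (S x y) (S a y) (S x a) (S a a))) (parity x y)
    moved true false _ _ =
      subst₂ Parity (cong (G x y xor_) (sym (BP.∨-identityʳ (G a y)))) (identity (S x y) (S a y) (S x a) (S a a) t)
             (parity-xor (parity x y) (parity a y) t-odd)
      where
      identity : ∀ s p q r t → s + t * p ≡ s + t * (+ 1 * p) + t * (+ 0 * q) + t * t * (+ 1 * + 0 * r)
      identity = solve-∀
    moved false true _ _ =
      subst (Parity (G x y xor G a x)) (identity (S x y) (S a y) (S x a) (S a a) t)
            (parity-xor (parity x y) (subst (Parity (G a x)) (symmetric a x) (parity a x)) t-odd)
      where
      identity : ∀ s p q r t → s + t * q ≡ s + t * (+ 0 * p) + t * (+ 1 * q) + t * t * (+ 0 * + 1 * r)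
      identity = solve-∀
    moved true true x=c y=c with ==⇒≡ x c x=c | ==⇒≡ y c y=c
    ... | refl | refl = subst₂ Parity (sym (BP.xor-identityʳ (G c c))) (sym entry-at-c) (parity c c)

  transform : Combination n → Combination n
  transform []            = []
  transform ((e , u) ∷ L) = (e , u) ∷ (t * e * δ u c , a) ∷ transform L

  pairing-transform : ∀ u M → pairing S′ u M ≡ pairing S u (transform M) + t * δ u c * pairing S a (transform M)
  pairing-transform u [] = identity t (δ u c)
    where
    identity : ∀ t d → + 0 ≡ + 0 + t * d * + 0
    identity = solve-∀
  pairing-transform u ((e , v) ∷ M) rewrite pairing-transform u M =
    identity e (S u v) (S u a) (S a v) (S a a) t (δ u c) (δ v c) (pairing S u (transform M)) (pairing S a (transform M))
    where
    identity : ∀ e suv sua sav saa t du dv Y Z →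
               e * (suv + t * (du * sav) + t * (dv * sua) + t * t * (du * dv * saa)) + (Y + t * du * Z)
               ≡ e * suv + (t * e * dv * sua + Y) + t * du * (e * sav + (t * e * dv * saa + Z))
    identity = solve-∀

  form-transform : ∀ L M → form S′ L M ≡ form S (transform L) (transform M)
  form-transform [] M = refl
  form-transform ((e , u) ∷ L) M rewrite form-transform L M | pairing-transform u M =
    identity e t (δ u c) (pairing S u (transform M)) (pairing S a (transform M)) (form S (transform L) (transform M))
    where
    identity : ∀ e t d Y Z W → e * (Y + t * d * Z) + W ≡ e * Y + (t * e * d * Z + W)
    identity = solve-∀

  coeff-transform : ∀ L w → coeff (transform L) w ≡ coeff L w + t * coeff L c * δ a w
  coeff-transform [] w = identity t (δ a w)
    where
    identity : ∀ t d → + 0 ≡ + 0 + t * + 0 * d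
    identity = solve-∀
  coeff-transform ((e , u) ∷ L) w rewrite coeff-transform L w =
    identity e t (δ u w) (δ u c) (δ a w) (coeff L w) (coeff L c)
    where
    identity : ∀ e t duw duc daw X Y →
               e * duw + (t * e * duc * daw + (X + t * Y * daw)) ≡ e * duw + X + t * (e * duc + Y) * daw
    identity = solve-∀

  positive′ : PositiveDefinite S′
  positive′ L form≤0 w =
    begin
      coeff L w                            ≡⟨ identity (coeff L w) t (δ a w) ⟨
      coeff L w + t * + 0 * δ a w          ≡⟨ cong (λ z → coeff L w + t * z * δ a w) coeff-c ⟨
      coeff L w + t * coeff L c * δ a w    ≡⟨ coeff-transform L w ⟨
      coeff (transform L) w                ≡⟨ vanishes w ⟩
      + 0                                  ∎
    where
    open ≡-Reasoning
    identity : ∀ x t d → x + t * + 0 * d ≡ x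
    identity = solve-∀
    vanishes : ∀ w → coeff (transform L) w ≡ + 0
    vanishes = positive (transform L) (subst (_≤ + 0) (form-transform L L) form≤0)
    coeff-c : coeff L c ≡ + 0
    coeff-c =
      begin
        coeff L c                            ≡⟨ identity′ (coeff L c) t (+ 0) ⟨
        coeff L c + t * coeff L c * + 0
          ≡⟨ cong (λ d → coeff L c + t * coeff L c * toℤ d) (≢⇒==-false (c≢a ∘ sym)) ⟨
        coeff L c + t * coeff L c * δ a c    ≡⟨ coeff-transform L c ⟨
        coeff (transform L) c                ≡⟨ vanishes c ⟩
        + 0                                  ∎
      where
      identity′ : ∀ x t d → x + t * x * + 0 ≡ x
      identity′ = solve-∀

  companion : Companion (basicMove c a G)
  companion = record
    { S = S′ ; symmetric = symmetric′ ; diagonal = diagonal′ ; parity = parity′ ; positive = positive′ }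

step-companion : ∀ {n} {G H : Adj n} → BMStep G H → Companion G → Companion H
step-companion (c , a , ca , H≡) C = companion-cong (λ x y → sym (H≡ x y)) (BasicMove.companion C ca)

step-reverse : ∀ {n} {G H : Adj n} → (∀ x → H x x ≡ false) → BMStep G H → BMStep H G
step-reverse {G = G} {H} H-loopless (c , a , ca , H≡) = c , a , Hca , G≡
  where
  G-loopless : ∀ x → G x x ≡ false
  G-loopless x = trans (sym (diagonal-kept (x == c))) (trans (sym (H≡ x x)) (H-loopless x))
    where
    diagonal-kept : ∀ b → G x x xor ((b ∧ not b ∧ G a x) ∨ (b ∧ not b ∧ G a x)) ≡ G x x
    diagonal-kept true  = BP.xor-identityʳ (G x x)
    diagonal-kept false = BP.xor-identityʳ (G x x)
  a≠c : (a == c) ≡ false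
  a≠c with a == c in a=c
  ... | false = refl
  ... | true with ==⇒≡ a c a=c
  ... | refl with trans (sym ca) (G-loopless a)
  ... | ()
  row-a : ∀ z → H a z ≡ G a z
  row-a z rewrite H≡ a z | a≠c | G-loopless a with z == c
  ... | true  = BP.xor-identityʳ (G a z)
  ... | false = BP.xor-identityʳ (G a z)
  Hca : Edge H c a
  Hca rewrite H≡ c a | ==-refl c | a≠c | G-loopless a | BP.xor-identityʳ (G c a) = ca
  G≡ : ∀ x y → G x y ≡ basicMove c a H x y
  G≡ x y rewrite row-a x | row-a y | H≡ x y = sym (xor-cancelʳ (G x y) _)
    where
    xor-cancelʳ : ∀ p q → (p xor q) xor q ≡ p
    xor-cancelʳ p q = trans (BP.xor-assoc p q q) (trans (cong (p xor_) (BP.xor-same q)) (BP.xor-identityʳ p))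

companion-BMEquiv : ∀ {n} {G H : Adj n} → BMEquiv G H → Companion H → Companion G
companion-BMEquiv ε                  C = C
companion-BMEquiv (bwd step ◅ steps) C = step-companion step (companion-BMEquiv steps C)
companion-BMEquiv (fwd step ◅ steps) C = step-companion (step-reverse (Companion.loopless C′) step) C′
  where C′ = companion-BMEquiv steps C

-- Gram realisations

⟪_,_⟫ : ∀ {N} → Vector ℤ N → Vector ℤ N → ℤ
⟪ u , v ⟫ = sum (λ r → u r * v r)

⟪⟫-comm : ∀ {N} (u v : Vector ℤ N) → ⟪ u , v ⟫ ≡ ⟪ v , u ⟫
⟪⟫-comm u v = sum-cong-≗ (λ r → ZP.*-comm (u r) (v r))

⟪⟫-zeroʳ : ∀ {N} (u : Vector ℤ N) → ⟪ u , (λ _ → + 0) ⟫ ≡ + 0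
⟪⟫-zeroʳ {zero}  u = refl
⟪⟫-zeroʳ {suc N} u = cong₂ _+_ (ZP.*-zeroʳ (u Fin.zero)) (⟪⟫-zeroʳ (u ∘ Fin.suc))

⟪⟫-linearʳ : ∀ {N} (u v w : Vector ℤ N) c →
             ⟪ u , (λ r → c * v r + w r) ⟫ ≡ c * ⟪ u , v ⟫ + ⟪ u , w ⟫
⟪⟫-linearʳ u v w c = begin
  sum (λ r → u r * (c * v r + w r))
    ≡⟨ sum-cong-≗ (λ r → identity (u r) (v r) (w r) c) ⟩
  sum (λ r → c * (u r * v r) + u r * w r)
    ≡⟨ ∑-distrib-+ (λ r → c * (u r * v r)) (λ r → u r * w r) ⟩
  sum (λ r → c * (u r * v r)) + ⟪ u , w ⟫
    ≡⟨ cong (_+ ⟪ u , w ⟫) (*-distribˡ-sum c (λ r → u r * v r)) ⟨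
  c * ⟪ u , v ⟫ + ⟪ u , w ⟫ ∎
  where
  open ≡-Reasoning
  identity : ∀ u v w c → u * (c * v + w) ≡ c * (u * v) + u * w
  identity = solve-∀

square-nonneg : ∀ a → + 0 ≤ a * a
square-nonneg (+ zero)  = +≤+ ℕ.z≤n
square-nonneg (+ suc n) = +≤+ ℕ.z≤n
square-nonneg -[1+ n ] = +≤+ ℕ.z≤n

⟪⟫-nonneg : ∀ {N} (w : Vector ℤ N) → + 0 ≤ ⟪ w , w ⟫
⟪⟫-nonneg {zero}  w = ZP.≤-refl
⟪⟫-nonneg {suc N} w = ZP.+-mono-≤ (square-nonneg (w Fin.zero)) (⟪⟫-nonneg (w ∘ Fin.suc))

nonneg-summands : ∀ {p q} → + 0 ≤ p → + 0 ≤ q → p + q ≤ + 0 → p ≤ + 0 × q ≤ + 0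
nonneg-summands {p} {q} 0≤p 0≤q p+q≤0 =
  ZP.≤-trans (subst (_≤ p + q) (ZP.+-identityʳ p) (ZP.+-monoʳ-≤ p 0≤q)) p+q≤0 ,
  ZP.≤-trans (subst (_≤ p + q) (ZP.+-identityˡ q) (ZP.+-monoˡ-≤ q 0≤p)) p+q≤0

⟪⟫-self≤0 : ∀ {N} (w : Vector ℤ N) → ⟪ w , w ⟫ ≤ + 0 → ∀ r → w r ≡ + 0
⟪⟫-self≤0 {suc N} w norm≤0 r
  with nonneg-summands (square-nonneg (w Fin.zero)) (⟪⟫-nonneg (w ∘ Fin.suc)) norm≤0
⟪⟫-self≤0 {suc N} w norm≤0 Fin.zero    | w₀²≤0 , _
  with ZP.i*j≡0⇒i≡0∨j≡0 (w Fin.zero) (ZP.≤-antisym w₀²≤0 (square-nonneg (w Fin.zero)))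
... | inj₁ w₀≡0 = w₀≡0
... | inj₂ w₀≡0 = w₀≡0
⟪⟫-self≤0 {suc N} w norm≤0 (Fin.suc r) | _ , rest≤0 = ⟪⟫-self≤0 (w ∘ Fin.suc) rest≤0 r

realise : ∀ {n N} → (Fin n → Vector ℤ N) → Combination n → Vector ℤ N
realise v []            r = + 0
realise v ((c , x) ∷ L) r = c * v x r + realise v L r

module GramCriterion {n N} (S : Matrix n) (v : Fin n → Vector ℤ N) (d : ℕ)
                     (gram : ∀ x y → + suc d * S x y ≡ ⟪ v x , v y ⟫)
                     (ι : Fin n → Vector ℤ N) (d′ : ℕ)
                     (left-inverse : ∀ w u → ⟪ ι w , v u ⟫ ≡ + suc d′ * δ u w) where

  pairing-realise : ∀ x M → + suc d * pairing S x M ≡ ⟪ v x , realise v M ⟫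
  pairing-realise x []            = trans (ZP.*-zeroʳ (+ suc d)) (sym (⟪⟫-zeroʳ (v x)))
  pairing-realise x ((c , y) ∷ M) = begin
    + suc d * (c * S x y + pairing S x M)
      ≡⟨ identity (+ suc d) c (S x y) (pairing S x M) ⟩
    c * (+ suc d * S x y) + + suc d * pairing S x M
      ≡⟨ cong₂ (λ p q → c * p + q) (gram x y) (pairing-realise x M) ⟩
    c * ⟪ v x , v y ⟫ + ⟪ v x , realise v M ⟫
      ≡⟨ ⟪⟫-linearʳ (v x) (v y) (realise v M) c ⟨
    ⟪ v x , realise v ((c , y) ∷ M) ⟫ ∎
    where
    open ≡-Reasoning
    identity : ∀ s c a b → s * (c * a + b) ≡ c * (s * a) + s * b
    identity = solve-∀

  form-realise : ∀ L M → + suc d * form S L M ≡ ⟪ realise v L , realise v M ⟫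
  form-realise []            M =
    trans (ZP.*-zeroʳ (+ suc d)) (sym (trans (⟪⟫-comm _ (realise v M)) (⟪⟫-zeroʳ (realise v M))))
  form-realise ((c , x) ∷ L) M = begin
    + suc d * (c * pairing S x M + form S L M)
      ≡⟨ identity (+ suc d) c (pairing S x M) (form S L M) ⟩
    c * (+ suc d * pairing S x M) + + suc d * form S L M
      ≡⟨ cong₂ (λ p q → c * p + q) (pairing-realise x M) (form-realise L M) ⟩
    c * ⟪ v x , realise v M ⟫ + ⟪ realise v L , realise v M ⟫
      ≡⟨ cong₂ (λ p q → c * p + q) (⟪⟫-comm (v x) _) (⟪⟫-comm (realise v L) _) ⟩
    c * ⟪ realise v M , v x ⟫ + ⟪ realise v M , realise v L ⟫
      ≡⟨ ⟪⟫-linearʳ (realise v M) (v x) (realise v L) c ⟨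
    ⟪ realise v M , realise v ((c , x) ∷ L) ⟫
      ≡⟨ ⟪⟫-comm (realise v M) _ ⟩
    ⟪ realise v ((c , x) ∷ L) , realise v M ⟫ ∎
    where
    open ≡-Reasoning
    identity : ∀ s c a b → s * (c * a + b) ≡ c * (s * a) + s * b
    identity = solve-∀

  coeff-realise : ∀ w L → ⟪ ι w , realise v L ⟫ ≡ + suc d′ * coeff L w
  coeff-realise w []            = trans (⟪⟫-zeroʳ (ι w)) (sym (ZP.*-zeroʳ (+ suc d′)))
  coeff-realise w ((c , u) ∷ L) = begin
    ⟪ ι w , realise v ((c , u) ∷ L) ⟫
      ≡⟨ ⟪⟫-linearʳ (ι w) (v u) (realise v L) c ⟩
    c * ⟪ ι w , v u ⟫ + ⟪ ι w , realise v L ⟫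
      ≡⟨ cong₂ (λ p q → c * p + q) (left-inverse w u) (coeff-realise w L) ⟩
    c * (+ suc d′ * δ u w) + + suc d′ * coeff L w
      ≡⟨ identity c (+ suc d′) (δ u w) (coeff L w) ⟩
    + suc d′ * coeff ((c , u) ∷ L) w ∎
    where
    open ≡-Reasoning
    identity : ∀ c s e x → c * (s * e) + s * x ≡ s * (c * e + x)
    identity = solve-∀

  positiveDefinite : PositiveDefinite S
  positiveDefinite L form≤0 w with ZP.i*j≡0⇒i≡0∨j≡0 (+ suc d′) scaled-coeff≡0
    where
    realised≡0 : ∀ r → realise v L r ≡ + 0
    realised≡0 = ⟪⟫-self≤0 (realise v L)
      (subst₂ _≤_ (form-realise L L) (ZP.*-zeroʳ (+ suc d)) (ZP.*-monoˡ-≤-nonNeg (+ suc d) form≤0))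
    scaled-coeff≡0 : + suc d′ * coeff L w ≡ + 0
    scaled-coeff≡0 = begin
      + suc d′ * coeff L w              ≡⟨ coeff-realise w L ⟨
      ⟪ ι w , realise v L ⟫             ≡⟨ sum-cong-≗ (λ r → cong (ι w r *_) (realised≡0 r)) ⟩
      ⟪ ι w , (λ _ → + 0) ⟫             ≡⟨ ⟪⟫-zeroʳ (ι w) ⟩
      + 0                               ∎
      where open ≡-Reasoning
  ... | inj₂ coeff≡0 = coeff≡0

cartan : ∀ {n} → Adj n → Matrix n
cartan H x y = if x == y then + 2 else - toℤ (H x y)

cartan-companion : ∀ {n} {H : Adj n} → (∀ x y → H x y ≡ H y x) → (∀ x → H x x ≡ false) →
                   PositiveDefinite (cartan H) → Companion H
cartan-companion {H = H} H-sym H-loopless pd = record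
  { S = cartan H ; symmetric = symmetric ; diagonal = diagonal ; parity = parity ; positive = pd }
  where
  symmetric : ∀ x y → cartan H x y ≡ cartan H y x
  symmetric x y rewrite ==-sym x y | H-sym x y = refl
  diagonal : ∀ x → cartan H x x ≡ + 2
  diagonal x rewrite ==-refl x = refl
  parity-neg-toℤ : ∀ b → Parity b (- toℤ b)
  parity-neg-toℤ true  = mod2 (- + 1) refl
  parity-neg-toℤ false = mod2 (+ 0) refl
  parity : ∀ x y → Parity (H x y) (cartan H x y)
  parity x y with x == y in x=y
  ... | false = parity-neg-toℤ (H x y)
  ... | true with ==⇒≡ x y x=y
  ... | refl rewrite H-loopless x = parity-two

joins : ℕ → ℕ → ℕ × ℕ → Bool
joins i j (a , b) = ((i ≡ᵇ a) ∧ (j ≡ᵇ b)) ∨ ((i ≡ᵇ b) ∧ (j ≡ᵇ a))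

adjacent : List (ℕ × ℕ) → ℕ → ℕ → Bool
adjacent []       i j = false
adjacent (e ∷ es) i j = joins i j e ∨ adjacent es i j

fromEdges-adjacent : ∀ {k} es (x y : Fin k) → fromEdges es x y ≡ adjacent es (toℕ x) (toℕ y)
fromEdges-adjacent []       x y = refl
fromEdges-adjacent (e ∷ es) x y = cong (joins (toℕ x) (toℕ y) e ∨_) (fromEdges-adjacent es x y)

adjacent-++ : ∀ xs ys i j → adjacent (xs ++ ys) i j ≡ adjacent xs i j ∨ adjacent ys i j
adjacent-++ []       ys i j = refl
adjacent-++ (e ∷ xs) ys i j =
  trans (cong (joins i j e ∨_) (adjacent-++ xs ys i j)) (sym (BP.∨-assoc (joins i j e) _ _))

joins-sym : ∀ i j e → joins i j e ≡ joins j i e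
joins-sym i j (a , b) =
  trans (BP.∨-comm ((i ≡ᵇ a) ∧ (j ≡ᵇ b)) ((i ≡ᵇ b) ∧ (j ≡ᵇ a)))
        (cong₂ _∨_ (BP.∧-comm (i ≡ᵇ b) (j ≡ᵇ a)) (BP.∧-comm (i ≡ᵇ a) (j ≡ᵇ b)))

adjacent-sym : ∀ es i j → adjacent es i j ≡ adjacent es j i
adjacent-sym []       i j = refl
adjacent-sym (e ∷ es) i j = cong₂ _∨_ (joins-sym i j e) (adjacent-sym es i j)

fromEdges-sym : ∀ {k} es (x y : Fin k) → fromEdges es x y ≡ fromEdges es y x
fromEdges-sym es x y =
  trans (fromEdges-adjacent es x y) (trans (adjacent-sym es (toℕ x) (toℕ y)) (sym (fromEdges-adjacent es y x)))

NoLoops : List (ℕ × ℕ) → Set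
NoLoops = All (λ e → proj₁ e ≢ proj₂ e)

joins-irrefl : ∀ i a b → a ≢ b → joins i i (a , b) ≡ false
joins-irrefl i a b a≢b with i ≡ᵇ a in i=a | i ≡ᵇ b in i=b
... | true  | true  = ⊥-elim (a≢b (trans (sym (≡ᵇ⇒≡ i a i=a)) (≡ᵇ⇒≡ i b i=b)))
... | true  | false = refl
... | false | true  = refl
... | false | false = refl

fromEdges-irrefl : ∀ {k} es → NoLoops es → ∀ (x : Fin k) → fromEdges es x x ≡ false
fromEdges-irrefl es no-loops x = trans (fromEdges-adjacent es x x) (irrefl es no-loops)
  where
  irrefl : ∀ es → NoLoops es → adjacent es (toℕ x) (toℕ x) ≡ false
  irrefl []             []               = refl
  irrefl ((a , b) ∷ es) (a≢b ∷ no-loops) =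
    cong₂ _∨_ (joins-irrefl (toℕ x) a b a≢b) (irrefl es no-loops)

pathEdges-noLoops : ∀ m → NoLoops (pathEdges m)
pathEdges-noLoops m = AllP.map⁺ (AllP.applyUpTo⁺₂ id _ (λ i → NP.1+n≢n ∘ sym))

shift : List (ℕ × ℕ) → List (ℕ × ℕ)
shift = map (Product.map suc suc)

adjacent-shift : ∀ es i j → adjacent (shift es) (suc i) (suc j) ≡ adjacent es i j
adjacent-shift []       i j = refl
adjacent-shift (e ∷ es) i j = cong (joins i j e ∨_) (adjacent-shift es i j)

adjacent-shift-zero : ∀ es j → adjacent (shift es) zero j ≡ false
adjacent-shift-zero []       j = refl
adjacent-shift-zero (e ∷ es) j = adjacent-shift-zero es j

pathEdges-suc : ∀ m → pathEdges (suc (suc m)) ≡ (0 , 1) ∷ shift (pathEdges (suc m))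
pathEdges-suc m = cong ((0 , 1) ∷_) (begin
  map step (applyUpTo suc m)                           ≡⟨ LP.map-applyUpTo suc step m ⟩
  applyUpTo (step ∘ suc) m                             ≡⟨ LP.map-applyUpTo id (Product.map suc suc ∘ step) m ⟨
  map (Product.map suc suc ∘ step) (applyUpTo id m)    ≡⟨ LP.map-∘ (applyUpTo id m) ⟩
  shift (pathEdges (suc m))                            ∎)
  where
  open ≡-Reasoning
  step : ℕ → ℕ × ℕ
  step i = i , suc i

adjacent-path-suc : ∀ m i j → adjacent (pathEdges (suc (suc m))) i j
                              ≡ joins i j (0 , 1) ∨ adjacent (shift (pathEdges (suc m))) i j
adjacent-path-suc m i j = cong (λ es → adjacent es i j) (pathEdges-suc m)

path-shift : ∀ m i j → adjacent (pathEdges (suc (suc m))) (suc i) (suc j) ≡ adjacent (pathEdges (suc m)) i j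
path-shift m i j = trans (adjacent-path-suc m (suc i) (suc j))
  (cong₂ _∨_ (BP.∧-zeroʳ (i ≡ᵇ 0)) (adjacent-shift (pathEdges (suc m)) i j))

path-beyond : ∀ m i j → m < i → adjacent (pathEdges (suc m)) i j ≡ false
path-beyond zero    i             j       _            = refl
path-beyond (suc m) (suc (suc i)) zero    (s≤s _)      = trans (adjacent-path-suc m (suc (suc i)) zero)
  (trans (adjacent-sym (shift (pathEdges (suc m))) (suc (suc i)) zero) (adjacent-shift-zero (pathEdges (suc m)) _))
path-beyond (suc m) (suc (suc i)) (suc j) (s≤s m<1+i) = trans (adjacent-path-suc m (suc (suc i)) (suc j))
  (trans (adjacent-shift (pathEdges (suc m)) (suc i) j) (path-beyond m (suc i) j m<1+i))

path-adjacent : ∀ m i j → i ℕ.≤ m → j ℕ.≤ m →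
                adjacent (pathEdges (suc m)) i j ≡ (suc i ≡ᵇ j) ∨ (suc j ≡ᵇ i)
path-adjacent zero    zero    zero    _         _         = refl
path-adjacent (suc m) zero    j       _         _         = trans (adjacent-path-suc m zero j)
  (trans (cong (joins zero j (0 , 1) ∨_) (adjacent-shift-zero (pathEdges (suc m)) j)) (hub j))
  where
  hub : ∀ j → joins zero j (0 , 1) ∨ false ≡ (1 ≡ᵇ j) ∨ (suc j ≡ᵇ 0)
  hub zero          = refl
  hub (suc zero)    = refl
  hub (suc (suc j)) = refl
path-adjacent (suc m) (suc i) zero    i≤m       _         =
  trans (adjacent-sym (pathEdges (suc (suc m))) (suc i) zero)
        (trans (path-adjacent (suc m) zero (suc i) z≤n i≤m) (BP.∨-comm (1 ≡ᵇ suc i) false))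
path-adjacent (suc m) (suc i) (suc j) (s≤s i≤m) (s≤s j≤m) =
  trans (path-shift m i j) (path-adjacent m i j i≤m j≤m)

-- Companions of Dynkin graphs

⟪⟫-linearˡ : ∀ {N} (c d : ℤ) (u v w : Vector ℤ N) →
             ⟪ (λ r → c * u r + d * v r) , w ⟫ ≡ c * ⟪ u , w ⟫ + d * ⟪ v , w ⟫
⟪⟫-linearˡ c d u v w = begin
  sum (λ r → (c * u r + d * v r) * w r)
    ≡⟨ sum-cong-≗ (λ r → identity c d (u r) (v r) (w r)) ⟩
  sum (λ r → c * (u r * w r) + d * (v r * w r))
    ≡⟨ ∑-distrib-+ (λ r → c * (u r * w r)) (λ r → d * (v r * w r)) ⟩
  sum (λ r → c * (u r * w r)) + sum (λ r → d * (v r * w r))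
    ≡⟨ cong₂ _+_ (*-distribˡ-sum c (λ r → u r * w r)) (*-distribˡ-sum d (λ r → v r * w r)) ⟨
  c * ⟪ u , w ⟫ + d * ⟪ v , w ⟫ ∎
  where
  open ≡-Reasoning
  identity : ∀ c d u v w → (c * u + d * v) * w ≡ c * (u * w) + d * (v * w)
  identity = solve-∀

vec : ∀ N → (ℕ → ℤ) → Vector ℤ N
vec N f r = f (toℕ r)

e : ℕ → ℕ → ℤ
e i r = toℤ (i ≡ᵇ r)

⟪e⟫ : ∀ {N} i (b : ℕ → ℤ) → i < N → ⟪ vec N (e i) , vec N b ⟫ ≡ b i
⟪e⟫ {suc N} zero    b _         =
  trans (cong₂ _+_ (ZP.*-identityˡ (b 0)) (sum-replicate-zero N)) (ZP.+-identityʳ (b 0))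
⟪e⟫ {suc N} (suc i) b (s≤s i<N) = trans (ZP.+-identityˡ _) (⟪e⟫ {N} i (b ∘ suc) i<N)

module TypeD (k : ℕ) where
  N ℓ : ℕ
  N = 4 ℕ.+ k
  ℓ = 3 ℕ.+ k

  Dₖ : Adj (4 ℕ.+ k)
  Dₖ = dynkinGraph (D k)

  edges : List (ℕ × ℕ)
  edges = pathEdges ℓ ++ (1 , ℓ) ∷ []

  -- The simple roots of D_{k+4} in ℤ^{k+4}: e_i − e_{i+1} for the path vertices 0 … k+2,
  -- and −(e₀ + e₁) for the leaf ℓ at 1.
  α : ℕ → ℕ → ℤ
  α i r = e i r - e (suc i) r

  β : ℕ → ℤ
  β r = - (e 0 r + e 1 r)

  ⟪α⟫ : ∀ i b → suc i < 4 ℕ.+ k → ⟪ vec N (α i) , vec N b ⟫ ≡ b i - b (suc i)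
  ⟪α⟫ i b 1+i<N = begin
    ⟪ vec N (α i) , vec N b ⟫
      ≡⟨ sum-cong-≗ {N} (λ r → cong (_* b (toℕ r)) (split (e i (toℕ r)) (e (suc i) (toℕ r)))) ⟩
    ⟪ (λ r → + 1 * vec N (e i) r + - + 1 * vec N (e (suc i)) r) , vec N b ⟫
      ≡⟨ ⟪⟫-linearˡ (+ 1) (- + 1) (vec N (e i)) (vec N (e (suc i))) (vec N b) ⟩
    + 1 * ⟪ vec N (e i) , vec N b ⟫ + - + 1 * ⟪ vec N (e (suc i)) , vec N b ⟫
      ≡⟨ cong₂ (λ p q → + 1 * p + - + 1 * q)
               (⟪e⟫ {N} i b (NP.<-trans (NP.n<1+n i) 1+i<N)) (⟪e⟫ {N} (suc i) b 1+i<N) ⟩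
    + 1 * b i + - + 1 * b (suc i)
      ≡⟨ split (b i) (b (suc i)) ⟨
    b i - b (suc i) ∎
    where
    open ≡-Reasoning
    split : ∀ x y → x - y ≡ + 1 * x + - + 1 * y
    split = solve-∀

  ⟪β⟫ : ∀ b → ⟪ vec N β , vec N b ⟫ ≡ - (b 0 + b 1)
  ⟪β⟫ b = begin
    ⟪ vec N β , vec N b ⟫
      ≡⟨ sum-cong-≗ {N} (λ r → cong (_* b (toℕ r)) (split (e 0 (toℕ r)) (e 1 (toℕ r)))) ⟩
    ⟪ (λ r → - + 1 * vec N (e 0) r + - + 1 * vec N (e 1) r) , vec N b ⟫
      ≡⟨ ⟪⟫-linearˡ (- + 1) (- + 1) (vec N (e 0)) (vec N (e 1)) (vec N b) ⟩
    - + 1 * ⟪ vec N (e 0) , vec N b ⟫ + - + 1 * ⟪ vec N (e 1) , vec N b ⟫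
      ≡⟨ cong₂ (λ p q → - + 1 * p + - + 1 * q) (⟪e⟫ {N} 0 b (s≤s z≤n)) (⟪e⟫ {N} 1 b (s≤s (s≤s z≤n))) ⟩
    - + 1 * b 0 + - + 1 * b 1
      ≡⟨ split (b 0) (b 1) ⟨
    - (b 0 + b 1) ∎
    where
    open ≡-Reasoning
    split : ∀ x y → - (x + y) ≡ - + 1 * x + - + 1 * y
    split = solve-∀

  path-entry : ∀ i j → α j i - α j (suc i)
                       ≡ (if i ≡ᵇ j then + 2 else - toℤ ((suc i ≡ᵇ j) ∨ (suc j ≡ᵇ i)))
  path-entry zero          zero          = refl
  path-entry zero          (suc zero)    = refl
  path-entry zero          (suc (suc j)) = refl
  path-entry (suc zero)    zero          = refl
  path-entry (suc (suc i)) zero          = refl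
  path-entry (suc i)       (suc j)       = path-entry i j

  leaf-path-entry : ∀ j → - (α j 0 + α j 1) ≡ - toℤ (j ≡ᵇ 1)
  leaf-path-entry zero          = refl
  leaf-path-entry (suc zero)    = refl
  leaf-path-entry (suc (suc j)) = refl

  path-leaf-entry : ∀ i → β i - β (suc i) ≡ - toℤ (i ≡ᵇ 1)
  path-leaf-entry zero          = refl
  path-leaf-entry (suc zero)    = refl
  path-leaf-entry (suc (suc i)) = refl

  adjacent-path : ∀ {i j} → i ℕ.≤ 2 ℕ.+ k → j ℕ.≤ 2 ℕ.+ k →
                  adjacent edges i j ≡ (suc i ≡ᵇ j) ∨ (suc j ≡ᵇ i)
  adjacent-path {i} {j} i≤ j≤ = begin
    adjacent edges i j
      ≡⟨ adjacent-++ (pathEdges ℓ) _ i j ⟩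
    adjacent (pathEdges ℓ) i j ∨ (joins i j (1 , ℓ) ∨ false)
      ≡⟨ cong₂ _∨_ (path-adjacent (2 ℕ.+ k) i j i≤ j≤) not-leaf ⟩
    ((suc i ≡ᵇ j) ∨ (suc j ≡ᵇ i)) ∨ false
      ≡⟨ BP.∨-identityʳ _ ⟩
    (suc i ≡ᵇ j) ∨ (suc j ≡ᵇ i) ∎
    where
    open ≡-Reasoning
    not-leaf : joins i j (1 , ℓ) ∨ false ≡ false
    not-leaf rewrite ≢⇒≡ᵇ-false (NP.<⇒≢ (s≤s j≤)) | ≢⇒≡ᵇ-false (NP.<⇒≢ (s≤s i≤))
                   | BP.∧-zeroʳ (i ≡ᵇ 1) = refl

  adjacent-leaf : ∀ {j} → j ℕ.≤ 2 ℕ.+ k → adjacent edges ℓ j ≡ (j ≡ᵇ 1)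
  adjacent-leaf {j} j≤ = begin
    adjacent edges ℓ j
      ≡⟨ adjacent-++ (pathEdges ℓ) _ ℓ j ⟩
    adjacent (pathEdges ℓ) ℓ j ∨ (joins ℓ j (1 , ℓ) ∨ false)
      ≡⟨ cong (_∨ (joins ℓ j (1 , ℓ) ∨ false)) (path-beyond (2 ℕ.+ k) ℓ j (NP.n<1+n _)) ⟩
    joins ℓ j (1 , ℓ) ∨ false
      ≡⟨ cong (λ b → (b ∧ (j ≡ᵇ 1)) ∨ false) (≡ᵇ-refl ℓ) ⟩
    (j ≡ᵇ 1) ∨ false
      ≡⟨ BP.∨-identityʳ _ ⟩
    (j ≡ᵇ 1) ∎
    where open ≡-Reasoning

  isLeaf : Fin (4 ℕ.+ k) → Bool
  isLeaf x = toℕ x ≡ᵇ ℓ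

  path-vertex : ∀ x → isLeaf x ≡ false → toℕ x ℕ.≤ 2 ℕ.+ k
  path-vertex x x-path = NP.≤-pred (NP.≤∧≢⇒< (NP.≤-pred (FP.toℕ<n x)) (≡ᵇ-false⇒≢ x-path))

  vertex : Bool → ℕ → ℕ → ℤ
  vertex true  i = β
  vertex false i = α i

  -- Twice the basis dual to α 0, …, α (2 + k), β.
  dual : Bool → ℕ → ℕ → ℤ
  dual true  w r = - + 1
  dual false w r = toℤ (w ≡ᵇ 0) - + 2 * toℤ (w <ᵇ r)

  v ι : Fin N → Vector ℤ N
  v x = vec N (vertex (isLeaf x) (toℕ x))
  ι x = vec N (dual (isLeaf x) (toℕ x))

  leaf : ∀ x → isLeaf x ≡ true → toℕ x ≡ ℓ
  leaf x = ≡ᵇ⇒≡ (toℕ x) ℓ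

  leaf≠path : ∀ x y → isLeaf x ≡ true → isLeaf y ≡ false → (toℕ x ≡ᵇ toℕ y) ≡ false
  leaf≠path x y x-leaf y-path = trans (cong (_≡ᵇ toℕ y) (leaf x x-leaf)) (trans (≡ᵇ-sym ℓ (toℕ y)) y-path)

  both-leaves : ∀ x y → isLeaf x ≡ true → isLeaf y ≡ true → x ≡ y
  both-leaves x y x-leaf y-leaf = FP.toℕ-injective (trans (leaf x x-leaf) (sym (leaf y y-leaf)))

  leaf-adjacency : ∀ x y → isLeaf x ≡ true → isLeaf y ≡ false → adjacent edges (toℕ x) (toℕ y) ≡ (toℕ y ≡ᵇ 1)
  leaf-adjacency x y x-leaf y-path =
    trans (cong (λ i → adjacent edges i (toℕ y)) (leaf x x-leaf)) (adjacent-leaf (path-vertex y y-path))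

  gram : ∀ x y → + 1 * cartan Dₖ x y ≡ ⟪ v x , v y ⟫
  gram x y = trans (ZP.*-identityˡ _) (entry (isLeaf x) (isLeaf y) refl refl)
    where
    open ≡-Reasoning
    off-diagonal : (x == y) ≡ false → cartan Dₖ x y ≡ - toℤ (adjacent edges (toℕ x) (toℕ y))
    off-diagonal x≠y = cong₂ (λ b c → if b then + 2 else - toℤ c) x≠y (fromEdges-adjacent edges x y)
    entry : ∀ bx by → isLeaf x ≡ bx → isLeaf y ≡ by →
            cartan Dₖ x y ≡ ⟪ vec N (vertex bx (toℕ x)) , vec N (vertex by (toℕ y)) ⟫
    entry false false x-path y-path = begin
      cartan Dₖ x y
        ≡⟨ cong (λ b → if x == y then + 2 else - toℤ b)
                (trans (fromEdges-adjacent edges x y) (adjacent-path (path-vertex x x-path) (path-vertex y y-path))) ⟩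
      (if toℕ x ≡ᵇ toℕ y then + 2 else - toℤ ((suc (toℕ x) ≡ᵇ toℕ y) ∨ (suc (toℕ y) ≡ᵇ toℕ x)))
        ≡⟨ path-entry (toℕ x) (toℕ y) ⟨
      α (toℕ y) (toℕ x) - α (toℕ y) (suc (toℕ x))
        ≡⟨ ⟪α⟫ (toℕ x) (α (toℕ y)) (s≤s (s≤s (path-vertex x x-path))) ⟨
      ⟪ vec N (α (toℕ x)) , vec N (α (toℕ y)) ⟫ ∎
    entry true false x-leaf y-path = begin
      cartan Dₖ x y
        ≡⟨ off-diagonal (leaf≠path x y x-leaf y-path) ⟩
      - toℤ (adjacent edges (toℕ x) (toℕ y))
        ≡⟨ cong (-_ ∘ toℤ) (leaf-adjacency x y x-leaf y-path) ⟩
      - toℤ (toℕ y ≡ᵇ 1)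
        ≡⟨ leaf-path-entry (toℕ y) ⟨
      - (α (toℕ y) 0 + α (toℕ y) 1)
        ≡⟨ ⟪β⟫ (α (toℕ y)) ⟨
      ⟪ vec N β , vec N (α (toℕ y)) ⟫ ∎
    entry false true x-path y-leaf = begin
      cartan Dₖ x y
        ≡⟨ off-diagonal (trans (≡ᵇ-sym (toℕ x) (toℕ y)) (leaf≠path y x y-leaf x-path)) ⟩
      - toℤ (adjacent edges (toℕ x) (toℕ y))
        ≡⟨ cong (-_ ∘ toℤ) (trans (adjacent-sym edges (toℕ x) (toℕ y)) (leaf-adjacency y x y-leaf x-path)) ⟩
      - toℤ (toℕ x ≡ᵇ 1)
        ≡⟨ path-leaf-entry (toℕ x) ⟨
      β (toℕ x) - β (suc (toℕ x))
        ≡⟨ ⟪α⟫ (toℕ x) β (s≤s (s≤s (path-vertex x x-path))) ⟨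
      ⟪ vec N (α (toℕ x)) , vec N β ⟫ ∎
    entry true true x-leaf y-leaf with both-leaves x y x-leaf y-leaf
    ... | refl rewrite ==-refl x = sym (⟪β⟫ β)

  dual-step : ∀ u w → dual false w u - dual false w (suc u) ≡ + 2 * toℤ (u ≡ᵇ w)
  dual-step u w = trans (identity (toℤ (w ≡ᵇ 0)) (toℤ (w <ᵇ u)) (toℤ (w <ᵇ suc u))) (cong (+ 2 *_) (step u w))
    where
    identity : ∀ z a b → z - + 2 * a - (z - + 2 * b) ≡ + 2 * (b - a)
    identity = solve-∀
    step : ∀ u w → toℤ (w <ᵇ suc u) - toℤ (w <ᵇ u) ≡ toℤ (u ≡ᵇ w)
    step zero    zero    = refl
    step zero    (suc w) = refl
    step (suc u) zero    = refl
    step (suc u) (suc w) = step u w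

  dual-orthogonal : ∀ w → - (dual false w 0 + dual false w 1) ≡ + 0
  dual-orthogonal zero    = refl
  dual-orthogonal (suc w) = refl

  left-inverse : ∀ w u → ⟪ ι w , v u ⟫ ≡ + 2 * δ u w
  left-inverse w u = trans (⟪⟫-comm (ι w) (v u)) (entry (isLeaf u) (isLeaf w) refl refl)
    where
    entry : ∀ bu bw → isLeaf u ≡ bu → isLeaf w ≡ bw →
            ⟪ vec N (vertex bu (toℕ u)) , vec N (dual bw (toℕ w)) ⟫ ≡ + 2 * δ u w
    entry false false u-path w-path = trans (⟪α⟫ (toℕ u) (dual false (toℕ w)) (s≤s (s≤s (path-vertex u u-path))))
                                            (dual-step (toℕ u) (toℕ w))
    entry true false u-leaf w-path rewrite leaf≠path u w u-leaf w-path =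
      trans (⟪β⟫ (dual false (toℕ w))) (dual-orthogonal (toℕ w))
    entry false true u-path w-leaf rewrite trans (≡ᵇ-sym (toℕ u) (toℕ w)) (leaf≠path w u w-leaf u-path) =
      ⟪α⟫ (toℕ u) (dual true (toℕ w)) (s≤s (s≤s (path-vertex u u-path)))
    entry true true u-leaf w-leaf with both-leaves u w u-leaf w-leaf
    ... | refl rewrite ==-refl u = ⟪β⟫ (dual true (toℕ u))

  companion : Companion Dₖ
  companion = cartan-companion (fromEdges-sym edges)
    (fromEdges-irrefl edges (AllP.++⁺ (pathEdges-noLoops ℓ) ((λ ()) ∷ [])))
    (GramCriterion.positiveDefinite (cartan Dₖ) v 0 gram ι 1 left-inverse)

A-in-D : ∀ k → HasInduced (dynkinGraph (D k)) (dynkinGraph (A k))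
A-in-D k = f , (λ i j → FP.inject₁-injective ∘ FP.suc-injective ∘ FP.suc-injective) , f-adj
  where
  f : Fin (suc k) → Fin (4 ℕ.+ k)
  f i = Fin.suc (Fin.suc (Fin.inject₁ i))
  f-adj : ∀ i j → dynkinGraph (D k) (f i) (f j) ≡ dynkinGraph (A k) i j
  f-adj i j = begin
    dynkinGraph (D k) (f i) (f j)
      ≡⟨ fromEdges-adjacent (dynkinEdges (D k)) (f i) (f j) ⟩
    adjacent (dynkinEdges (D k)) (2 ℕ.+ toℕ (Fin.inject₁ i)) (2 ℕ.+ toℕ (Fin.inject₁ j))
      ≡⟨ cong₂ (λ p q → adjacent (dynkinEdges (D k)) (2 ℕ.+ p) (2 ℕ.+ q))
               (FP.toℕ-inject₁ i) (FP.toℕ-inject₁ j) ⟩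
    adjacent (dynkinEdges (D k)) (2 ℕ.+ toℕ i) (2 ℕ.+ toℕ j)
      ≡⟨ adjacent-++ (pathEdges (3 ℕ.+ k)) _ (2 ℕ.+ toℕ i) (2 ℕ.+ toℕ j) ⟩
    adjacent (pathEdges (3 ℕ.+ k)) (2 ℕ.+ toℕ i) (2 ℕ.+ toℕ j) ∨ (((toℕ i ≡ᵇ suc k) ∧ false) ∨ false)
      ≡⟨ cong₂ _∨_ (trans (path-shift (suc k) _ _) (path-shift k _ _)) (cong (_∨ false) (BP.∧-zeroʳ _)) ⟩
    adjacent (pathEdges (suc k)) (toℕ i) (toℕ j) ∨ false
      ≡⟨ BP.∨-identityʳ _ ⟩
    adjacent (pathEdges (suc k)) (toℕ i) (toℕ j)
      ≡⟨ fromEdges-adjacent (pathEdges (suc k)) i j ⟨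
    dynkinGraph (A k) i j ∎
    where open ≡-Reasoning

all² : ∀ {m} {P : Fin m → Fin m → Set} → (∀ i j → Dec (P i j)) → Dec (∀ i j → P i j)
all² P? = FP.all? (λ i → FP.all? (P? i))

module TypeE8 where
  E₈ : Adj 8
  E₈ = dynkinGraph E8

  table : Vec (Vec ℤ 8) 8 → Fin 8 → Vector ℤ 8
  table rows x = lookup (lookup rows x)

  -- Twice the simple roots of E₈ in the standard coordinates of ℤ⁸ ∪ (ℤ + ½)⁸.
  v : Fin 8 → Vector ℤ 8
  v = table
    ( (+ 0   ∷ - + 2 ∷ + 2   ∷ + 0   ∷ + 0   ∷ + 0   ∷ + 0   ∷ + 0 ∷ [])
    ∷ (+ 2   ∷ + 2   ∷ + 0   ∷ + 0   ∷ + 0   ∷ + 0   ∷ + 0   ∷ + 0 ∷ [])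
    ∷ (- + 2 ∷ + 2   ∷ + 0   ∷ + 0   ∷ + 0   ∷ + 0   ∷ + 0   ∷ + 0 ∷ [])
    ∷ (+ 1   ∷ - + 1 ∷ - + 1 ∷ - + 1 ∷ - + 1 ∷ - + 1 ∷ - + 1 ∷ + 1 ∷ [])
    ∷ (+ 0   ∷ + 0   ∷ - + 2 ∷ + 2   ∷ + 0   ∷ + 0   ∷ + 0   ∷ + 0 ∷ [])
    ∷ (+ 0   ∷ + 0   ∷ + 0   ∷ - + 2 ∷ + 2   ∷ + 0   ∷ + 0   ∷ + 0 ∷ [])
    ∷ (+ 0   ∷ + 0   ∷ + 0   ∷ + 0   ∷ - + 2 ∷ + 2   ∷ + 0   ∷ + 0 ∷ [])
    ∷ (+ 0   ∷ + 0   ∷ + 0   ∷ + 0   ∷ + 0   ∷ - + 2 ∷ + 2   ∷ + 0 ∷ [])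
    ∷ [])

  -- Twice the fundamental weights, so that ⟪ ι w , v u ⟫ = 4 δ_uw.
  ι : Fin 8 → Vector ℤ 8
  ι = table
    ( (+ 0   ∷ + 0 ∷ + 2 ∷ + 2 ∷ + 2 ∷ + 2 ∷ + 2 ∷ + 10 ∷ [])
    ∷ (+ 1   ∷ + 1 ∷ + 1 ∷ + 1 ∷ + 1 ∷ + 1 ∷ + 1 ∷ + 5  ∷ [])
    ∷ (- + 1 ∷ + 1 ∷ + 1 ∷ + 1 ∷ + 1 ∷ + 1 ∷ + 1 ∷ + 7  ∷ [])
    ∷ (+ 0   ∷ + 0 ∷ + 0 ∷ + 0 ∷ + 0 ∷ + 0 ∷ + 0 ∷ + 4  ∷ [])
    ∷ (+ 0   ∷ + 0 ∷ + 0 ∷ + 2 ∷ + 2 ∷ + 2 ∷ + 2 ∷ + 8  ∷ [])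
    ∷ (+ 0   ∷ + 0 ∷ + 0 ∷ + 0 ∷ + 2 ∷ + 2 ∷ + 2 ∷ + 6  ∷ [])
    ∷ (+ 0   ∷ + 0 ∷ + 0 ∷ + 0 ∷ + 0 ∷ + 2 ∷ + 2 ∷ + 4  ∷ [])
    ∷ (+ 0   ∷ + 0 ∷ + 0 ∷ + 0 ∷ + 0 ∷ + 0 ∷ + 2 ∷ + 2  ∷ [])
    ∷ [])

  companion : Companion E₈
  companion = cartan-companion
    (from-yes (all² λ x y → E₈ x y BP.≟ E₈ y x))
    (from-yes (FP.all? λ x → E₈ x x BP.≟ false))
    (GramCriterion.positiveDefinite (cartan E₈)
      v 3 (from-yes (all² λ x y → + 4 * cartan E₈ x y ZP.≟ ⟪ v x , v y ⟫))
      ι 3 (from-yes (all² λ w u → ⟪ ι w , v u ⟫ ZP.≟ + 4 * δ u w)))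

E6-in-E8 : HasInduced (dynkinGraph E8) (dynkinGraph E6)
E6-in-E8 = (_↑ˡ 2) , FP.↑ˡ-injective 2 ,
           from-yes (all² λ i j → dynkinGraph E8 (i ↑ˡ 2) (j ↑ˡ 2) BP.≟ dynkinGraph E6 i j)

E7-in-E8 : HasInduced (dynkinGraph E8) (dynkinGraph E7)
E7-in-E8 = (_↑ˡ 1) , FP.↑ˡ-injective 1 ,
           from-yes (all² λ i j → dynkinGraph E8 (i ↑ˡ 1) (j ↑ˡ 1) BP.≟ dynkinGraph E7 i j)

dynkin-companion : ∀ {n} (t : DynkinType n) → Companion (dynkinGraph t)
dynkin-companion (A k) = restrict (A-in-D k) (TypeD.companion k)
dynkin-companion (D k) = TypeD.companion k
dynkin-companion E6    = restrict E6-in-E8 TypeE8.companion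
dynkin-companion E7    = restrict E7-in-E8 TypeE8.companion
dynkin-companion E8    = TypeE8.companion

-- Graphs of type D^(1)

IsUnit : ℤ → Set
IsUnit s = s ≡ + 1 ⊎ s ≡ - + 1

unit-odd : ∀ {s} → IsUnit s → Parity true s
unit-odd (inj₁ refl) = mod2 (+ 0) refl
unit-odd (inj₂ refl) = mod2 (- + 1) refl

zero-or-unit : ∀ s → ¬ (+ 4 + + 2 * s ≤ + 0) → ¬ (+ 4 - + 2 * s ≤ + 0) → s ≡ + 0 ⊎ IsUnit s
zero-or-unit (+ 0)           _ _ = inj₁ refl
zero-or-unit (+ 1)           _ _ = inj₂ (inj₁ refl)
zero-or-unit -[1+ 0 ]        _ _ = inj₂ (inj₂ refl)
zero-or-unit (+ suc (suc j)) _ h = ⊥-elim (h (subst (_≤ + 0) (sym (identity (+ j))) ZP.neg-≤-pos))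
  where
  identity : ∀ J → + 4 - + 2 * (+ 2 + J) ≡ - (J + J)
  identity = solve-∀
zero-or-unit -[1+ suc j ]    h _ = ⊥-elim (h (subst (_≤ + 0) (sym (identity (+ j))) ZP.neg-≤-pos))
  where
  identity : ∀ J → + 4 + + 2 * - (+ 2 + J) ≡ - (J + J)
  identity = solve-∀

module Entries {n} {G : Adj n} (C : Companion G) where
  open Companion C

  -- For t = ±1, e_x + t e_y has norm 4 + 2 t S x y, so positivity forces ∣ S x y ∣ ≤ 1.
  probe : Fin n → Fin n → ℤ → Combination n
  probe x y t = (t , y) ∷ (+ 1 , x) ∷ []

  form-probe : ∀ x y t → form S (probe x y t) (probe x y t) ≡ + 2 * (t * t) + + 2 * t * S x y + + 2
  form-probe x y t rewrite diagonal x | diagonal y | symmetric y x = identity t (S x y)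
    where
    identity : ∀ t s → t * (t * + 2 + (+ 1 * s + + 0)) + (+ 1 * (t * s + (+ 1 * + 2 + + 0)) + + 0)
                       ≡ + 2 * (t * t) + + 2 * t * s + + 2
    identity = solve-∀

  coeff-probe : ∀ {x y} t → x ≢ y → coeff (probe x y t) x ≡ + 1
  coeff-probe {x} t x≢y rewrite ≢⇒==-false (x≢y ∘ sym) | ==-refl x = identity t
    where
    identity : ∀ t → t * + 0 + (+ 1 * + 1 + + 0) ≡ + 1
    identity = solve-∀

  probe-positive : ∀ {x y} t → x ≢ y → ¬ (+ 2 * (t * t) + + 2 * t * S x y + + 2 ≤ + 0)
  probe-positive {x} {y} t x≢y norm≤0
    with trans (sym (coeff-probe t x≢y)) (positive (probe x y t) (subst (_≤ + 0) (sym (form-probe x y t)) norm≤0) x)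
  ... | ()

  offDiagonal : ∀ {x y} → x ≢ y → S x y ≡ + 0 ⊎ IsUnit (S x y)
  offDiagonal {x} {y} x≢y = zero-or-unit (S x y)
    (probe-positive (+ 1) x≢y ∘ subst (_≤ + 0) (plus (S x y)))
    (probe-positive (- + 1) x≢y ∘ subst (_≤ + 0) (minus (S x y)))
    where
    plus : ∀ s → + 4 + + 2 * s ≡ + 2 * (+ 1 * + 1) + + 2 * + 1 * s + + 2
    plus = solve-∀
    minus : ∀ s → + 4 - + 2 * s ≡ + 2 * (- + 1 * - + 1) + + 2 * - + 1 * s + + 2
    minus = solve-∀

  nonEdge⇒zero : ∀ {x y} → x ≢ y → G x y ≡ false → S x y ≡ + 0
  nonEdge⇒zero {x} {y} x≢y nonEdge with offDiagonal x≢y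
  ... | inj₁ S≡0 = S≡0
  ... | inj₂ unit with parity-unique (unit-odd unit) (subst (λ b → Parity b (S x y)) nonEdge (parity x y))
  ... | ()

  edge⇒unit : ∀ {x y} → G x y ≡ true → IsUnit (S x y)
  edge⇒unit {x} {y} edge with offDiagonal x≢y
    where
    x≢y : x ≢ y
    x≢y refl with trans (sym edge) (loopless x)
    ... | ()
  ... | inj₂ unit = unit
  ... | inj₁ S≡0 with parity-unique {b = false} (mod2 (+ 0) S≡0) (subst (λ b → Parity b (S x y)) edge (parity x y))
  ... | ()

∧-true : ∀ {p q} → (p ∧ q) ≡ true → p ≡ true × q ≡ true
∧-true {true} {true} _ = refl , refl

∨-true : ∀ {p q} → (p ∨ q) ≡ true → p ≡ true ⊎ q ≡ true
∨-true {true}  _      = inj₁ refl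
∨-true {false} q≡true = inj₂ q≡true

joins-true : ∀ i j a b → joins i j (a , b) ≡ true → (i ≡ a × j ≡ b) ⊎ (i ≡ b × j ≡ a)
joins-true i j a b joined with ∨-true joined
... | inj₁ ab with ∧-true ab
...   | i=a , j=b = inj₁ (≡ᵇ⇒≡ i a i=a , ≡ᵇ⇒≡ j b j=b)
joins-true i j a b joined | inj₂ ba with ∧-true ba
...   | i=b , j=a = inj₂ (≡ᵇ⇒≡ i b i=b , ≡ᵇ⇒≡ j a j=a)

xor-disjoint : ∀ p a₁ a₂ → (a₁ ∨ a₂ ≡ true → p ≡ false) → p xor (a₁ ∨ a₂) ≡ a₁ ∨ (a₂ ∨ p)
xor-disjoint p false false _        = BP.xor-identityʳ p
xor-disjoint p true  a₂    disjoint rewrite disjoint refl = refl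
xor-disjoint p false true  disjoint rewrite disjoint refl = refl

-- On affineD (1 + k), φ_{1,0} joins 1 to the leaves 2 + k, 3 + k of 0; deleting 0 then
-- leaves affineD k, shifted by one.
module Shortening (k : ℕ) where
  toLeaf₁ toLeaf₂ : ℕ → ℕ → Bool
  toLeaf₁ i j = joins i j (0 , suc k)
  toLeaf₂ i j = joins i j (0 , 2 ℕ.+ k)

  rightEnd core : List (ℕ × ℕ)
  rightEnd = (k , 3 ℕ.+ k) ∷ (k , 4 ℕ.+ k) ∷ []
  core     = pathEdges (suc k) ++ rightEnd

  affine-split : ∀ i j → adjacent (affineDEdges k) i j ≡ toLeaf₁ i j ∨ (toLeaf₂ i j ∨ adjacent core i j)
  affine-split i j = begin
    adjacent (affineDEdges k) i j
      ≡⟨ adjacent-++ (pathEdges (suc k)) _ i j ⟩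
    path ∨ (toLeaf₁ i j ∨ (toLeaf₂ i j ∨ adjacent rightEnd i j))
      ≡⟨ rotate path (toLeaf₁ i j) (toLeaf₂ i j) (adjacent rightEnd i j) ⟩
    toLeaf₁ i j ∨ (toLeaf₂ i j ∨ (path ∨ adjacent rightEnd i j))
      ≡⟨ cong (λ b → toLeaf₁ i j ∨ (toLeaf₂ i j ∨ b)) (adjacent-++ (pathEdges (suc k)) rightEnd i j) ⟨
    toLeaf₁ i j ∨ (toLeaf₂ i j ∨ adjacent core i j) ∎
    where
    open ≡-Reasoning
    path : Bool
    path = adjacent (pathEdges (suc k)) i j
    rotate : ∀ p a b r → p ∨ (a ∨ (b ∨ r)) ≡ a ∨ (b ∨ (p ∨ r))
    rotate false a b r = refl
    rotate true  a b r = sym (trans (cong (a ∨_) (BP.∨-zeroʳ b)) (BP.∨-zeroʳ a))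

  affine-suc : ∀ i j → adjacent (affineDEdges (suc k)) (suc i) (suc j) ≡ adjacent core i j
  affine-suc i j = begin
    adjacent (affineDEdges (suc k)) (suc i) (suc j)
      ≡⟨ adjacent-++ (pathEdges (2 ℕ.+ k)) _ (suc i) (suc j) ⟩
    adjacent (pathEdges (2 ℕ.+ k)) (suc i) (suc j) ∨ ((i₁ ∧ false) ∨ ((i₂ ∧ false) ∨ adjacent rightEnd i j))
      ≡⟨ cong₂ _∨_ (path-shift k i j)
                   (cong₂ (λ p q → p ∨ (q ∨ adjacent rightEnd i j)) (BP.∧-zeroʳ i₁) (BP.∧-zeroʳ i₂)) ⟩
    adjacent (pathEdges (suc k)) i j ∨ adjacent rightEnd i j
      ≡⟨ adjacent-++ (pathEdges (suc k)) rightEnd i j ⟨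
    adjacent core i j ∎
    where
    open ≡-Reasoning
    i₁ i₂ : Bool
    i₁ = i ≡ᵇ suc k
    i₂ = i ≡ᵇ 2 ℕ.+ k

  hub-neighbours : ∀ j → adjacent (affineDEdges (suc k)) 0 (2 ℕ.+ j) ≡ toLeaf₁ 0 (suc j) ∨ toLeaf₂ 0 (suc j)
  hub-neighbours j = trans (adjacent-++ (pathEdges (2 ℕ.+ k)) _ 0 (2 ℕ.+ j))
    (cong₂ _∨_ (trans (adjacent-path-suc k 0 (2 ℕ.+ j)) (adjacent-shift-zero (pathEdges (suc k)) _))
               (cong (toLeaf₁ 0 (suc j) ∨_) (BP.∨-identityʳ _)))

  leaf-isolated : ∀ i j → k < i → i < 3 ℕ.+ k → adjacent core i j ≡ false
  leaf-isolated i j k<i i<3+k = trans (adjacent-++ (pathEdges (suc k)) _ i j) isolated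
    where
    isolated : adjacent (pathEdges (suc k)) i j ∨ (joins i j (k , 3 ℕ.+ k) ∨ (joins i j (k , 4 ℕ.+ k) ∨ false))
               ≡ false
    isolated rewrite path-beyond k i j k<i | ≢⇒≡ᵇ-false (NP.>⇒≢ k<i) | ≢⇒≡ᵇ-false (NP.<⇒≢ i<3+k)
                   | ≢⇒≡ᵇ-false (NP.<⇒≢ (NP.m<n⇒m<1+n i<3+k)) = refl

  leaf-edge-avoids-core : ∀ {i j l} → k < l → l < 3 ℕ.+ k → (i ≡ 0 × j ≡ l) ⊎ (i ≡ l × j ≡ 0) →
                          adjacent core i j ≡ false
  leaf-edge-avoids-core {l = l} k<l l<3+k (inj₁ (refl , refl)) =
    trans (adjacent-sym core 0 l) (leaf-isolated l 0 k<l l<3+k)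
  leaf-edge-avoids-core {l = l} k<l l<3+k (inj₂ (refl , refl)) = leaf-isolated l 0 k<l l<3+k

  core-avoids-leaves : ∀ i j → toLeaf₁ i j ∨ toLeaf₂ i j ≡ true → adjacent core i j ≡ false
  core-avoids-leaves i j leaf-edge with ∨-true leaf-edge
  ... | inj₁ edge = leaf-edge-avoids-core (NP.n<1+n k) (NP.m<n⇒m<1+n (NP.n<1+n (suc k)))
                                          (joins-true i j 0 (suc k) edge)
  ... | inj₂ edge = leaf-edge-avoids-core (NP.m<n⇒m<1+n (NP.n<1+n k)) (NP.n<1+n (2 ℕ.+ k))
                                          (joins-true i j 0 (2 ℕ.+ k) edge)

  -- The term by which basicMove 1F 0F toggles the adjacency of 1 + i and 1 + j.
  toggle : ℕ → ℕ → Bool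
  toggle i j = ((i ≡ᵇ 0) ∧ not (j ≡ᵇ 0) ∧ adjacent (affineDEdges (suc k)) 0 (suc j))
             ∨ ((j ≡ᵇ 0) ∧ not (i ≡ᵇ 0) ∧ adjacent (affineDEdges (suc k)) 0 (suc i))

  toggle-leaves : ∀ i j → toggle i j ≡ toLeaf₁ i j ∨ toLeaf₂ i j
  toggle-leaves zero    zero    = refl
  toggle-leaves zero    (suc j) = trans (BP.∨-identityʳ _) (hub-neighbours j)
  toggle-leaves (suc i) zero    =
    trans (hub-neighbours i) (cong₂ _∨_ (joins-sym 0 (suc i) (0 , suc k)) (joins-sym 0 (suc i) (0 , 2 ℕ.+ k)))
  toggle-leaves (suc i) (suc j) = sym (cong₂ _∨_ (BP.∧-zeroʳ (i ≡ᵇ k)) (BP.∧-zeroʳ (i ≡ᵇ suc k)))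

  adjacent-shorten : ∀ i j → adjacent (affineDEdges (suc k)) (suc i) (suc j) xor toggle i j
                             ≡ adjacent (affineDEdges k) i j
  adjacent-shorten i j = begin
    adjacent (affineDEdges (suc k)) (suc i) (suc j) xor toggle i j
      ≡⟨ cong₂ _xor_ (affine-suc i j) (toggle-leaves i j) ⟩
    adjacent core i j xor (toLeaf₁ i j ∨ toLeaf₂ i j)
      ≡⟨ xor-disjoint (adjacent core i j) (toLeaf₁ i j) (toLeaf₂ i j) (core-avoids-leaves i j) ⟩
    toLeaf₁ i j ∨ (toLeaf₂ i j ∨ adjacent core i j)
      ≡⟨ affine-split i j ⟨
    adjacent (affineDEdges k) i j ∎
    where open ≡-Reasoning

  affineD-shorten : ∀ i j → basicMove 1F 0F (affineD (suc k)) (Fin.suc i) (Fin.suc j) ≡ affineD k i j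
  affineD-shorten i j = begin
    basicMove 1F 0F (affineD (suc k)) (Fin.suc i) (Fin.suc j)
      ≡⟨ cong₂ _xor_ (fromEdges-adjacent E′ (Fin.suc i) (Fin.suc j))
                     (cong₂ _∨_ (cong (λ b → (i′ ≡ᵇ 0) ∧ not (j′ ≡ᵇ 0) ∧ b) (fromEdges-adjacent E′ 0F (Fin.suc j)))
                                (cong (λ b → (j′ ≡ᵇ 0) ∧ not (i′ ≡ᵇ 0) ∧ b) (fromEdges-adjacent E′ 0F (Fin.suc i)))) ⟩
    adjacent E′ (suc i′) (suc j′) xor toggle i′ j′
      ≡⟨ adjacent-shorten i′ j′ ⟩
    adjacent (affineDEdges k) i′ j′
      ≡⟨ fromEdges-adjacent (affineDEdges k) i j ⟨
    affineD k i j ∎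
    where
    open ≡-Reasoning
    E′ : List (ℕ × ℕ)
    E′ = affineDEdges (suc k)
    i′ j′ : ℕ
    i′ = toℕ i
    j′ = toℕ j

-- The matrix of a companion of the star affineD 0 (hub 0) with hub–leaf entries s.
starMatrix : Vec ℤ 4 → Matrix 5
starMatrix s Fin.zero    Fin.zero    = + 2
starMatrix s Fin.zero    (Fin.suc i) = lookup s i
starMatrix s (Fin.suc i) Fin.zero    = lookup s i
starMatrix s (Fin.suc i) (Fin.suc j) = if i == j then + 2 else + 0

starNull : Vec ℤ 4 → Combination 5
starNull s = (+ 2 , 0F) ∷ (- lookup s 0F , 1F) ∷ (- lookup s 1F , 2F)
                        ∷ (- lookup s 2F , 3F) ∷ (- lookup s 3F , 4F) ∷ []

coeff-starNull : ∀ s → coeff (starNull s) 0F ≡ + 2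
coeff-starNull s = identity (- lookup s 0F) (- lookup s 1F) (- lookup s 2F) (- lookup s 3F)
  where
  identity : ∀ a b c d → + 2 * + 1 + (a * + 0 + (b * + 0 + (c * + 0 + (d * + 0 + + 0)))) ≡ + 2
  identity = solve-∀

starNull-isotropic : ∀ {s₀ s₁ s₂ s₃} → IsUnit s₀ → IsUnit s₁ → IsUnit s₂ → IsUnit s₃ →
                     let s = s₀ ∷ s₁ ∷ s₂ ∷ s₃ ∷ [] in form (starMatrix s) (starNull s) (starNull s) ≡ + 0
starNull-isotropic (inj₁ refl) (inj₁ refl) (inj₁ refl) (inj₁ refl) = refl
starNull-isotropic (inj₁ refl) (inj₁ refl) (inj₁ refl) (inj₂ refl) = refl
starNull-isotropic (inj₁ refl) (inj₁ refl) (inj₂ refl) (inj₁ refl) = refl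
starNull-isotropic (inj₁ refl) (inj₁ refl) (inj₂ refl) (inj₂ refl) = refl
starNull-isotropic (inj₁ refl) (inj₂ refl) (inj₁ refl) (inj₁ refl) = refl
starNull-isotropic (inj₁ refl) (inj₂ refl) (inj₁ refl) (inj₂ refl) = refl
starNull-isotropic (inj₁ refl) (inj₂ refl) (inj₂ refl) (inj₁ refl) = refl
starNull-isotropic (inj₁ refl) (inj₂ refl) (inj₂ refl) (inj₂ refl) = refl
starNull-isotropic (inj₂ refl) (inj₁ refl) (inj₁ refl) (inj₁ refl) = refl
starNull-isotropic (inj₂ refl) (inj₁ refl) (inj₁ refl) (inj₂ refl) = refl
starNull-isotropic (inj₂ refl) (inj₁ refl) (inj₂ refl) (inj₁ refl) = refl
starNull-isotropic (inj₂ refl) (inj₁ refl) (inj₂ refl) (inj₂ refl) = refl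
starNull-isotropic (inj₂ refl) (inj₂ refl) (inj₁ refl) (inj₁ refl) = refl
starNull-isotropic (inj₂ refl) (inj₂ refl) (inj₁ refl) (inj₂ refl) = refl
starNull-isotropic (inj₂ refl) (inj₂ refl) (inj₂ refl) (inj₁ refl) = refl
starNull-isotropic (inj₂ refl) (inj₂ refl) (inj₂ refl) (inj₂ refl) = refl

star-noCompanion : ¬ Companion (affineD 0)
star-noCompanion C = 2≢0 (trans (sym (coeff-starNull s)) (positive (starNull s) (ZP.≤-reflexive isotropic) 0F))
  where
  open Companion C
  open Entries C
  s : Vec ℤ 4
  s = tabulate (λ i → S 0F (Fin.suc i))
  hub-edge : ∀ i → affineD 0 0F (Fin.suc i) ≡ true
  hub-edge = from-yes (FP.all? λ i → affineD 0 0F (Fin.suc i) BP.≟ true)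
  leaves-apart : ∀ i j → affineD 0 (Fin.suc i) (Fin.suc j) ≡ false
  leaves-apart = from-yes (all² λ i j → affineD 0 (Fin.suc i) (Fin.suc j) BP.≟ false)
  entries : ∀ x y → S x y ≡ starMatrix s x y
  entries Fin.zero    Fin.zero    = diagonal 0F
  entries Fin.zero    (Fin.suc i) = sym (lookup∘tabulate (λ i → S 0F (Fin.suc i)) i)
  entries (Fin.suc i) Fin.zero    = trans (symmetric (Fin.suc i) 0F) (sym (lookup∘tabulate (λ i → S 0F (Fin.suc i)) i))
  entries (Fin.suc i) (Fin.suc j) with i Fin.≟ j
  ... | yes refl rewrite ==-refl i = diagonal (Fin.suc i)
  ... | no  i≢j  rewrite ≢⇒==-false i≢j = nonEdge⇒zero (i≢j ∘ FP.suc-injective) (leaves-apart i j)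
  isotropic : form S (starNull s) (starNull s) ≡ + 0
  isotropic = trans (form-cong entries (starNull s) (starNull s))
    (starNull-isotropic (edge⇒unit (hub-edge 0F)) (edge⇒unit (hub-edge 1F))
                        (edge⇒unit (hub-edge 2F)) (edge⇒unit (hub-edge 3F)))
  2≢0 : + 2 ≢ + 0
  2≢0 ()

affineD-noCompanion : ∀ k → ¬ Companion (affineD k)
affineD-noCompanion zero    = star-noCompanion
affineD-noCompanion (suc k) C =
  affineD-noCompanion k (restrict (Fin.suc , (λ _ _ → FP.suc-injective) , Shortening.affineD-shorten k)
                                   (BasicMove.companion C {1F} {0F} refl))

proposition5p10 : ∀ {n} (G : Adj n) → IsSimple G → Connected G →
    (Σ ℕ λ k → HasInduced G (affineD k)) →
    ¬ (Σ (Adj n) λ H → BMEquiv G H × IsDynkin H)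
proposition5p10 G _ _ (k , affineD⊆G) (H , G∼H , t , H≅t) =
  affineD-noCompanion k (restrict affineD⊆G G-companion)
  where
  H-companion : Companion H
  H-companion = restrict (iso⇒induced {H = dynkinGraph t} H≅t) (dynkin-companion t)
  G-companion : Companion G
  G-companion = companion-BMEquiv G∼H H-companion
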